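{- Let $G$ be a connected non-bipartite graph, let $k$ be a positive integer, and let $f$ be an integer additive set-indexer of $G$. Then $f$ is a strongly $k$-uniform integer additive set-indexer if and only if $k$ is a perfect square and $f$ is a $(k,l)$-completely uniform integer additive set-indexer with $l=\sqrt{k}$.
   Context: All graphs are simple, finite and have no isolated vertices. Set-labels are non-empty finite subsets of the non-negative integers $\mathbb{N}_0$. For sets $A,B$, $A+B=\{a+b: a\in A, b\in B\}$. An integer additive set-indexer (IASI) of $G$ is an injective $f:V(G)\to 2^{\mathbb{N}_0}$ such that $f^+:E(G)\to 2^{\mathbb{N}_0}$, $f^+(uv)=f(u)+f(v)$, is injective. An IASI is $k$-uniform if $|f^+(e)|=k$ for all edges $e$. It is strong if $|f^+(uv)|=|f(u)|\,|f(v)|$ for every edge $uv$, and strongly $k$-uniform if it is strong and $k$-uniform. An IASI $f$ is $(k,l)$-completely uniform if it is $k$-uniform and $|f(v)|=l$ for every vertex $v$. -}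

module Defs where

open import Data.Nat using (ℕ; _+_; _*_; _≟_)
open import Data.Fin using (Fin)
open import Data.Bool using (Bool)
open import Data.List using (List; []; _∷_; length; deduplicate; concatMap; map)
open import Data.List.Membership.Propositional using (_∈_)
open import Data.Product using (Σ; ∃; _×_; _,_)
open import Data.Sum using (_⊎_)
open import Data.Empty using (⊥)
open import Relation.Nullary using (¬_)
open import Relation.Binary.PropositionalEquality using (_≡_; _≢_)
open import Function.Bundles using (_⇔_)

-- Finite sets of naturals, represented by lists (duplicates / order
-- irrelevant).  Set equality is extensional; cardinality counts distinct
-- elements.

SetLabel : Set
SetLabel = List ℕ

_≈ˢ_ : SetLabel → SetLabel → Set
A ≈ˢ B = ∀ x → (x ∈ A) ⇔ (x ∈ B)

card : SetLabel → ℕ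
card A = length (deduplicate _≟_ A)

_⊕_ : SetLabel → SetLabel → SetLabel
A ⊕ B = concatMap (λ a → map (a +_) B) A

NonEmpty : SetLabel → Set
NonEmpty A = A ≢ []

record Graph : Set₁ where
  field
    n       : ℕ
    Adj     : Fin n → Fin n → Set
    sym     : ∀ {u v} → Adj u v → Adj v u
    irrefl  : ∀ {u} → ¬ Adj u u
    noIsol  : ∀ u → ∃ λ v → Adj u v

open Graph public

data Walk (G : Graph) : Fin (n G) → Fin (n G) → Set where
  here : ∀ {u} → Walk G u u
  step : ∀ {u v w} → Adj G u v → Walk G v w → Walk G u w

Connected : Graph → Set
Connected G = ∀ u v → Walk G u v

Bipartite : Graph → Set
Bipartite G = Σ (Fin (n G) → Bool) λ c → ∀ u v → Adj G u v → c u ≢ c v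

Labelling : Graph → Set
Labelling G = Fin (n G) → SetLabel

record IsIASI (G : Graph) (f : Labelling G) : Set where
  field
    nonEmpty  : ∀ v → NonEmpty (f v)
    injective : ∀ u v → f u ≈ˢ f v → u ≡ v
    edgeInj   : ∀ u v u' v' → Adj G u v → Adj G u' v' →
                (f u ⊕ f v) ≈ˢ (f u' ⊕ f v') →
                (u ≡ u' × v ≡ v') ⊎ (u ≡ v' × v ≡ u')

KUniform : (G : Graph) → Labelling G → ℕ → Set
KUniform G f k = ∀ u v → Adj G u v → card (f u ⊕ f v) ≡ k

Strong : (G : Graph) → Labelling G → Set
Strong G f = ∀ u v → Adj G u v → card (f u ⊕ f v) ≡ card (f u) * card (f v)

StronglyKUniform : (G : Graph) → Labelling G → ℕ → Set
StronglyKUniform G f k = Strong G f × KUniform G f k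

CompletelyUniform : (G : Graph) → Labelling G → ℕ → ℕ → Set
CompletelyUniform G f k l = KUniform G f k × (∀ v → card (f v) ≡ l)

-- Strong k-uniformity means |f u| · |f v| = k on every edge.  Along an edge the
-- label size of one end determines that of the other, so along any walk the
-- sizes alternate between two values a and k/a.  Colouring each vertex by
-- whether its size equals a is then a proper 2-colouring unless a · a = k; in
-- a non-bipartite graph this forces a · a = k, and then every size equals a.
module Submission where

open import Defs hiding (sym)
open import Data.Nat using (ℕ; zero; suc; _*_; _≥_; _≟_; NonZero; >-nonZero; ≢-nonZero⁻¹)
open import Data.Nat.Properties using (*-cancelˡ-≡; *-comm)
open import Data.Fin as Fin using (Fin)
open import Data.Fin.Properties using (¬Fin0)
open import Data.Bool using (Bool)
open import Data.Product using (∃; _×_; _,_)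
open import Data.Sum using (_⊎_; inj₁; inj₂)
open import Relation.Nullary using (¬_; yes; no; contradiction)
open import Relation.Nullary.Decidable using (isYes)
open import Relation.Binary.PropositionalEquality
  using (_≡_; _≢_; refl; sym; trans; cong₂; subst)
open import Function.Bundles using (_⇔_; mk⇔)

product-cancelˡ : ∀ {k} .{{_ : NonZero k}} x {y z} → x * y ≡ k → x * z ≡ k → y ≡ z
product-cancelˡ zero        p _ = contradiction (sym p) (≢-nonZero⁻¹ _)
product-cancelˡ x@(suc _) p q = *-cancelˡ-≡ _ _ x (trans p (sym q))

nonBipartite⇒vertex : ∀ G → ¬ Bipartite G → Fin (n G)
nonBipartite⇒vertex G nb = vertexOf (n G) (λ h → nb ((λ v → contradiction v h) , λ u → contradiction u h))
  where
  vertexOf : ∀ m → ¬ ¬ Fin m → Fin m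
  vertexOf zero    ¬¬v = contradiction ¬Fin0 ¬¬v
  vertexOf (suc m) _   = Fin.zero

module EdgeProduct {G : Graph} (c : Fin (n G) → ℕ) {k : ℕ} {{_ : NonZero k}}
                   (edge-product : ∀ {u v} → Adj G u v → c u * c v ≡ k) where

  walk-alternates : ∀ {u v} → Walk G u v → c v ≡ c u ⊎ c u * c v ≡ k
  walk-alternates here = inj₁ refl
  walk-alternates {u} (step {v = w} uw wv) with walk-alternates wv
  ... | inj₁ v≡w   = inj₂ (subst (λ x → c u * x ≡ k) (sym v≡w) (edge-product uw))
  ... | inj₂ w·v≡k = inj₁ (product-cancelˡ (c w) w·v≡k (trans (*-comm (c w) (c u)) (edge-product uw)))

  module FromVertex (conn : Connected G) (v₀ : Fin (n G)) where

    a : ℕ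
    a = c v₀

    alternates : ∀ v → c v ≡ a ⊎ a * c v ≡ k
    alternates v = walk-alternates (conn v₀ v)

    square⇒constant : a * a ≡ k → ∀ v → c v ≡ a
    square⇒constant a·a≡k v with alternates v
    ... | inj₁ v≡a   = v≡a
    ... | inj₂ a·v≡k = product-cancelˡ a a·v≡k a·a≡k

    colour : Fin (n G) → Bool
    colour v = isYes (c v ≟ a)

    sameColour⇒sameSize : ∀ u w → colour u ≡ colour w → c u ≡ c w
    sameColour⇒sameSize u w eq with c u ≟ a | c w ≟ a | alternates u | alternates w
    ... | yes u≡a | yes w≡a | _ | _ = trans u≡a (sym w≡a)
    ... | no u≢a  | no w≢a  | inj₂ a·u≡k | inj₂ a·w≡k = product-cancelˡ a a·u≡k a·w≡k
    ... | no u≢a  | _       | inj₁ u≡a | _ = contradiction u≡a u≢a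
    ... | _       | no w≢a  | _ | inj₁ w≡a = contradiction w≡a w≢a

    squareSize⇒a : ∀ v → c v * c v ≡ k → c v ≡ a
    squareSize⇒a v v·v≡k with alternates v
    ... | inj₁ v≡a   = v≡a
    ... | inj₂ a·v≡k = product-cancelˡ (c v) v·v≡k (trans (*-comm (c v) a) a·v≡k)

    nonSquare⇒bipartite : a * a ≢ k → Bipartite G
    nonSquare⇒bipartite a·a≢k = colour , proper
      where
      proper : ∀ u w → Adj G u w → colour u ≢ colour w
      proper u w uw same = a·a≢k (subst (λ x → x * x ≡ k) (squareSize⇒a u u·u≡k) u·u≡k)
        where
        u·u≡k : c u * c u ≡ k
        u·u≡k = subst (λ x → c u * x ≡ k) (sym (sameColour⇒sameSize u w same)) (edge-product uw)

    nonBipartite⇒square : ¬ Bipartite G → a * a ≡ k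
    nonBipartite⇒square nb with a * a ≟ k
    ... | yes a·a≡k = a·a≡k
    ... | no  a·a≢k = contradiction (nonSquare⇒bipartite a·a≢k) nb

  nonBipartite⇒constantSquareRoot : Connected G → ¬ Bipartite G → ∃ λ l → l * l ≡ k × ∀ v → c v ≡ l
  nonBipartite⇒constantSquareRoot conn nb = a , a·a≡k , square⇒constant a·a≡k
    where
    open FromVertex conn (nonBipartite⇒vertex G nb)
    a·a≡k : a * a ≡ k
    a·a≡k = nonBipartite⇒square nb

theorem7 : (G : Graph) → Connected G → ¬ Bipartite G →
    (k : ℕ) → k ≥ 1 → (f : Labelling G) → IsIASI G f →
    StronglyKUniform G f k ⇔ (∃ λ l → l * l ≡ k × CompletelyUniform G f k l)
theorem7 G conn nb k k≥1 f _ = mk⇔ to from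
  where
  instance
    k≢0 : NonZero k
    k≢0 = >-nonZero k≥1

  to : StronglyKUniform G f k → ∃ λ l → l * l ≡ k × CompletelyUniform G f k l
  to (strong , uniform) with EdgeProduct.nonBipartite⇒constantSquareRoot (λ v → card (f v))
                               (λ {u} {v} uv → trans (sym (strong u v uv)) (uniform u v uv)) conn nb
  ... | l , l·l≡k , sizes = l , l·l≡k , uniform , sizes

  from : (∃ λ l → l * l ≡ k × CompletelyUniform G f k l) → StronglyKUniform G f k
  from (l , l·l≡k , uniform , sizes) = strong , uniform
    where
    strong : Strong G f
    strong u v uv = trans (uniform u v uv) (sym (trans (cong₂ _*_ (sizes u) (sizes v)) l·l≡k))
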